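{- Let $c\ge 3$ and $n\ge 1$ be integers and $a,b,d$ pairwise distinct colors in $\{1,\dots,c\}$. Then $$\left|\Pi_n^{eq}\wr C_c(1^a1^b1^a)\right|=\left|\Pi_n^{eq}\wr C_c(1^a1^b1^d)\right|.$$
   Context: $\Pi_n\wr C_c$ is the set of colored set partitions of $[n]$: a set partition of $[n]$ together with a color in $\{1,\dots,c\}$ for each element. For colors $\gamma_1,\gamma_2,\gamma_3$, a colored partition eq-contains $1^{\gamma_1}1^{\gamma_2}1^{\gamma_3}$ iff some block contains elements $x<y<z$ with $x,y,z$ colored $\gamma_1,\gamma_2,\gamma_3$ respectively; $\Pi_n^{eq}\wr C_c(P)$ is the set of colored partitions not eq-containing $P$. -}

module Defs where

open import Data.Nat using (ℕ; zero; suc; _≡ᵇ_; _≤ᵇ_; _<ᵇ_; _⊔_)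
open import Data.Bool using (Bool; true; false; _∧_; _∨_; not; T)
open import Data.Fin using (Fin; toℕ)
open import Data.Fin.Properties using () renaming (_≟_ to _≟ᶠ_)
open import Data.Vec using (Vec; []; _∷_; lookup)
open import Data.List using (List; allFin)
open import Data.Bool.ListAction using (any)
open import Data.Product using (Σ; _×_; _,_)
open import Relation.Nullary.Decidable using (⌊_⌋)

-- A set partition of [n] = {0,…,n-1} is encoded canonically by its
-- restricted growth string (block labels): v i is the index of the block
-- of i, blocks numbered in order of their minimal elements.
-- rgsFrom m v : every entry is ≤ the number m of blocks opened so far.
rgsFrom : {n : ℕ} → ℕ → Vec ℕ n → Bool
rgsFrom m [] = true
rgsFrom m (x ∷ xs) = (x ≤ᵇ m) ∧ rgsFrom (m ⊔ suc x) xs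

IsRGS : {n : ℕ} → Vec ℕ n → Set
IsRGS v = T (rgsFrom 0 v)

SetPartition : ℕ → Set
SetPartition n = Σ (Vec ℕ n) IsRGS

ColoredPartition : ℕ → ℕ → Set
ColoredPartition n c = SetPartition n × Vec (Fin c) n

sameBlock : {n : ℕ} → SetPartition n → Fin n → Fin n → Bool
sameBlock (v , _) x y = lookup v x ≡ᵇ lookup v y

hasColor : {n c : ℕ} → Vec (Fin c) n → Fin n → Fin c → Bool
hasColor col x γ = ⌊ lookup col x ≟ᶠ γ ⌋

-- eq-containment of 1^{γ1} 1^{γ2} 1^{γ3}: some block contains x<y<z
-- colored γ1, γ2, γ3 respectively.
eqContains : {n c : ℕ} → ColoredPartition n c → Fin c → Fin c → Fin c → Bool
eqContains {n} (p , col) γ₁ γ₂ γ₃ =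
  any (λ x → any (λ y → any (λ z →
        (toℕ x <ᵇ toℕ y) ∧ (toℕ y <ᵇ toℕ z)
      ∧ sameBlock p x y ∧ sameBlock p y z
      ∧ hasColor col x γ₁ ∧ hasColor col y γ₂ ∧ hasColor col z γ₃)
      (allFin n)) (allFin n)) (allFin n)

Avoiders : (n c : ℕ) → Fin c → Fin c → Fin c → Set
Avoiders n c γ₁ γ₂ γ₃ =
  Σ (ColoredPartition n c) (λ π → T (not (eqContains π γ₁ γ₂ γ₃)))

module Submission where

-- Fix the block structure of a coloured partition and the two
-- colours a, b.  Call an element z *marked* when its block contains
-- elements x < y < z coloured a and b.  For a colour map f, recolouring
-- every marked element by f (and leaving the others alone) does not change
-- which elements are marked: an a/b pair that got recoloured was itself
-- marked, and its marking pair lies further to the left in the same block.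
-- Consequently recolouring by f and then by g is the identity whenever
-- g ∘ f is, and an occurrence of 1^a 1^b 1^γ (a marked element of colour
-- γ) becomes an occurrence of 1^a 1^b 1^(f γ).  So for any permutation π of
-- the colours, recolouring by π is a bijection from the colourings avoiding
-- 1^a 1^b 1^γ to those avoiding 1^a 1^b 1^(π γ).  The theorem is the case
-- where π is the transposition of a and d and γ = a.

open import Defs
open import Data.Nat as ℕ using (ℕ; _≥_; suc; _<_; s≤s)
open import Data.Nat.Properties
  using (<-trans; <-≤-trans; n<1+n; <ᵇ-reflects-<; ≡ᵇ⇒≡; ≡⇒≡ᵇ)
open import Data.Fin as Fin using (Fin; toℕ)
open import Data.Fin.Properties using (any?)
open import Data.Fin.Permutation using (Permutation′; _⟨$⟩ʳ_; _⟨$⟩ˡ_; inverseˡ; inverseʳ; transpose)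
open import Data.Bool using (Bool; true; false; not; T; if_then_else_)
open import Data.Bool.Properties using (T-irrelevant)
open import Data.Bool.ListAction using (any)
open import Data.Product using (Σ-syntax; ∃; _×_; _,_)
open import Data.Vec using (Vec; lookup; tabulate)
open import Data.Vec.Properties using (lookup∘tabulate; tabulate∘lookup; tabulate-cong)
open import Data.List using (allFin)
open import Data.List.Relation.Unary.Any using (satisfied)
open import Data.List.Relation.Unary.Any.Properties using (any⁺; any⁻)
open import Data.List.Membership.Propositional using (lose)
open import Data.List.Membership.Propositional.Properties using (∈-allFin)
open import Relation.Nullary using (Dec; yes; no; does; _because_; Reflects; ofʸ; ofⁿ; ¬_)
open import Relation.Nullary.Decidable using (map′; isYes; dec-true; dec-false)
open import Relation.Nullary.Reflects using (_×-reflects_; fromEquivalence)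
open import Relation.Unary using (Decidable)
open import Relation.Binary.PropositionalEquality using (_≢_; _≡_; refl; sym; trans; cong; subst₂)
open import Function.Base using (_∘_)
open import Function.Bundles using (_⇔_; mk⇔; Equivalence; _⤖_; _↔_; mk↔ₛ′)
open import Function.Properties.Inverse using (↔⇒⤖)

open Equivalence using (to; from)

any-allFin : ∀ {n} (p : Fin n → Bool) → T (any p (allFin n)) ⇔ ∃ (T ∘ p)
any-allFin {n} p = mk⇔ (λ t → satisfied (any⁻ p (allFin n) t))
                       (λ (i , pi) → any⁺ p (lose (∈-allFin i) pi))

T-does : ∀ {A : Set} (d : Dec A) → T (does d) ⇔ A
T-does (true  because ofʸ a)  = mk⇔ (λ _ → a) (λ _ → _)
T-does (false because ofⁿ ¬a) = mk⇔ (λ ()) ¬a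

isYes-reflects : ∀ {A : Set} (d : Dec A) → Reflects A (isYes d)
isYes-reflects (true  because r) = r
isYes-reflects (false because r) = r

T-not : ∀ b → T (not b) ⇔ (¬ T b)
T-not false = mk⇔ (λ _ ()) (λ _ → _)
T-not true  = mk⇔ (λ ()) (λ ¬t → ¬t _)

lookup-extensional : ∀ {A : Set} {n} {xs ys : Vec A n} →
                     (∀ i → lookup xs i ≡ lookup ys i) → xs ≡ ys
lookup-extensional {xs = xs} {ys} eq =
  trans (sym (tabulate∘lookup xs)) (trans (tabulate-cong eq) (tabulate∘lookup ys))

transpose-source : ∀ {c} (i j : Fin c) → transpose i j ⟨$⟩ʳ i ≡ j
transpose-source i j rewrite dec-true (i Fin.≟ i) refl = refl

module Occurrences {n c : ℕ} (v : Vec ℕ n) where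

  record Preceded (col : Vec (Fin c) n) (g₁ g₂ : Fin c) (z : Fin n) : Set where
    constructor preceded
    field
      x y   : Fin n
      x<y   : toℕ x < toℕ y
      y<z   : toℕ y < toℕ z
      x~y   : lookup v x ≡ lookup v y
      y~z   : lookup v y ≡ lookup v z
      col-x : lookup col x ≡ g₁
      col-y : lookup col y ≡ g₂

  Occurrence : Vec (Fin c) n → Fin c → Fin c → Fin c → Set
  Occurrence col g₁ g₂ g₃ = Σ[ z ∈ Fin n ] (Preceded col g₁ g₂ z × lookup col z ≡ g₃)

  OccursAt : Vec (Fin c) n → (g₁ g₂ g₃ : Fin c) → (x y z : Fin n) → Set
  OccursAt col g₁ g₂ g₃ x y z =
    toℕ x < toℕ y × toℕ y < toℕ z × lookup v x ≡ lookup v y × lookup v y ≡ lookup v z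
      × lookup col x ≡ g₁ × lookup col y ≡ g₂ × lookup col z ≡ g₃

  -- The body of eqContains reflects OccursAt, conjunct by conjunct; packaged
  -- as a decision procedure whose boolean is that body.
  occursAt? : ∀ col g₁ g₂ g₃ x y z → Dec (OccursAt col g₁ g₂ g₃ x y z)
  occursAt? col g₁ g₂ g₃ x y z = _ because (
    <ᵇ-reflects-< _ _ ×-reflects <ᵇ-reflects-< _ _
      ×-reflects ≡ᵇ-reflects-≡ ×-reflects ≡ᵇ-reflects-≡
      ×-reflects isYes-reflects (lookup col x Fin.≟ g₁)
      ×-reflects isYes-reflects (lookup col y Fin.≟ g₂)
      ×-reflects isYes-reflects (lookup col z Fin.≟ g₃))
    where
    ≡ᵇ-reflects-≡ : ∀ {m m′} → Reflects (m ≡ m′) (m ℕ.≡ᵇ m′)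
    ≡ᵇ-reflects-≡ = fromEquivalence (≡ᵇ⇒≡ _ _) (≡⇒≡ᵇ _ _)

  preceded-at : ∀ {col g₁ g₂ z} → (Σ[ x ∈ Fin n ] Σ[ y ∈ Fin n ]
                OccursAt col g₁ g₂ (lookup col z) x y z) ⇔ Preceded col g₁ g₂ z
  preceded-at = mk⇔ (λ (x , y , x<y , y<z , x~y , y~z , cx , cy , _) → preceded x y x<y y<z x~y y~z cx cy)
                    (λ (preceded x y x<y y<z x~y y~z cx cy) → x , y , x<y , y<z , x~y , y~z , cx , cy , refl)

  preceded? : ∀ col g₁ g₂ → Decidable (Preceded col g₁ g₂)
  preceded? col g₁ g₂ z =
    map′ (to preceded-at) (from preceded-at)
         (any? λ x → any? λ y → occursAt? col g₁ g₂ (lookup col z) x y z)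

  preceded-extend : ∀ {col g₁ g₂ w z} → Preceded col g₁ g₂ w →
                    toℕ w < toℕ z → lookup v w ≡ lookup v z → Preceded col g₁ g₂ z
  preceded-extend (preceded x y x<y y<w x~y y~w cx cy) w<z w~z =
    preceded x y x<y (<-trans y<w w<z) x~y (trans y~w w~z) cx cy

  occurrence⇔ : ∀ {r : IsRGS v} col g₁ g₂ g₃ →
                T (eqContains ((v , r) , col) g₁ g₂ g₃) ⇔ Occurrence col g₁ g₂ g₃
  occurrence⇔ {r} col g₁ g₂ g₃ = mk⇔ decode encode
    where
    decode : T (eqContains ((v , r) , col) g₁ g₂ g₃) → Occurrence col g₁ g₂ g₃
    decode t with to (any-allFin _) t
    ... | x , t₁ with to (any-allFin _) t₁
    ... | y , t₂ with to (any-allFin _) t₂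
    ... | z , t₃ with to (T-does (occursAt? col g₁ g₂ g₃ x y z)) t₃
    ... | x<y , y<z , x~y , y~z , cx , cy , cz = z , preceded x y x<y y<z x~y y~z cx cy , cz

    encode : Occurrence col g₁ g₂ g₃ → T (eqContains ((v , r) , col) g₁ g₂ g₃)
    encode (z , preceded x y x<y y<z x~y y~z cx cy , cz) =
      from (any-allFin _) (x , from (any-allFin _) (y , from (any-allFin _) (z ,
        from (T-does (occursAt? col g₁ g₂ g₃ x y z)) (x<y , y<z , x~y , y~z , cx , cy , cz))))

  avoidance⇔ : ∀ {r : IsRGS v} col g₁ g₂ g₃ →
               T (not (eqContains ((v , r) , col) g₁ g₂ g₃)) ⇔ (¬ Occurrence col g₁ g₂ g₃)
  avoidance⇔ {r} col g₁ g₂ g₃ =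
    mk⇔ (λ t → to (T-not contains) t ∘ from (occurrence⇔ {r} col g₁ g₂ g₃))
        (λ ¬occ → from (T-not contains) (¬occ ∘ to (occurrence⇔ {r} col g₁ g₂ g₃)))
    where
    contains : Bool
    contains = eqContains ((v , r) , col) g₁ g₂ g₃

module Recolouring {n c : ℕ} (v : Vec ℕ n) (a b : Fin c) where
  open Occurrences {c = c} v

  Marked : Vec (Fin c) n → Fin n → Set
  Marked col = Preceded col a b

  recolourAt : (Fin c → Fin c) → Vec (Fin c) n → Fin n → Fin c
  recolourAt f col z = if does (preceded? col a b z) then f (lookup col z) else lookup col z

  recolour : (Fin c → Fin c) → Vec (Fin c) n → Vec (Fin c) n
  recolour f col = tabulate (recolourAt f col)

  lookup-marked : ∀ f {col z} → Marked col z → lookup (recolour f col) z ≡ f (lookup col z)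
  lookup-marked f {col} {z} m =
    trans (lookup∘tabulate (recolourAt f col) z)
          (cong (λ t → if t then f (lookup col z) else lookup col z) (dec-true (preceded? col a b z) m))

  lookup-unmarked : ∀ f {col z} → ¬ Marked col z → lookup (recolour f col) z ≡ lookup col z
  lookup-unmarked f {col} {z} ¬m =
    trans (lookup∘tabulate (recolourAt f col) z)
          (cong (λ t → if t then f (lookup col z) else lookup col z) (dec-false (preceded? col a b z) ¬m))

  -- A mark in the recoloured colouring is a mark in the original one: if x
  -- or y changed colour it was itself marked, and its marking pair (which
  -- lies further left in the same block) also marks z.
  marked-reflect : ∀ f {col z} → Marked (recolour f col) z → Marked col z
  marked-reflect f {col} (preceded x y x<y y<z x~y y~z cx cy)
    with preceded? col a b x | preceded? col a b y
  ... | yes mx | _     = preceded-extend mx (<-trans x<y y<z) (trans x~y y~z)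
  ... | no ¬mx | yes my = preceded-extend my y<z y~z
  ... | no ¬mx | no ¬my =
    preceded x y x<y y<z x~y y~z (trans (sym (lookup-unmarked f ¬mx)) cx)
                                 (trans (sym (lookup-unmarked f ¬my)) cy)

  -- If the marking pair
  -- x, y still has colours a, b we are done; otherwise one of them is marked
  -- and we pass to its marking pair, whose second element is further left.
  -- The recursion is on a bound k for the position of y.
  marked-preserve : ∀ f {col z} → Marked col z → Marked (recolour f col) z
  marked-preserve f {col} m = go (suc (toℕ (Preceded.y m))) m (n<1+n _)
    where
    go : ∀ k {z} (m : Marked col z) → toℕ (Preceded.y m) < k → Marked (recolour f col) z
    go (suc k) (preceded x y x<y y<z x~y y~z cx cy) (s≤s y<k)
      with preceded? col a b x | preceded? col a b y
    ... | yes mx | _ =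
      go k (preceded-extend mx (<-trans x<y y<z) (trans x~y y~z))
           (<-≤-trans (<-trans (Preceded.y<z mx) x<y) y<k)
    ... | no ¬mx | yes my =
      go k (preceded-extend my y<z y~z) (<-≤-trans (Preceded.y<z my) y<k)
    ... | no ¬mx | no ¬my =
      preceded x y x<y y<z x~y y~z (trans (lookup-unmarked f ¬mx) cx)
                                   (trans (lookup-unmarked f ¬my) cy)

  recolour-inverse : ∀ {f g} → (∀ γ → g (f γ) ≡ γ) → ∀ col → recolour g (recolour f col) ≡ col
  recolour-inverse {f} {g} g∘f col = lookup-extensional restored
    where
    restored : ∀ z → lookup (recolour g (recolour f col)) z ≡ lookup col z
    restored z with preceded? col a b z
    ... | yes m = trans (lookup-marked g (marked-preserve f m))
                        (trans (cong g (lookup-marked f m)) (g∘f (lookup col z)))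
    ... | no ¬m = trans (lookup-unmarked g (¬m ∘ marked-reflect f))
                        (lookup-unmarked f ¬m)

  occurrence-recolour : ∀ f {col γ} → Occurrence col a b γ →
                        Occurrence (recolour f col) a b (f γ)
  occurrence-recolour f (z , m , cz) = z , marked-preserve f m , trans (lookup-marked f m) (cong f cz)

  avoidance-recolour : ∀ {f g γ δ} → (∀ γ → g (f γ) ≡ γ) → f γ ≡ δ → ∀ col →
                       ¬ Occurrence col a b γ → ¬ Occurrence (recolour f col) a b δ
  avoidance-recolour {f} {g} {γ} g∘f fγ≡δ col avoids occ =
    avoids (subst₂ (λ col′ γ′ → Occurrence col′ a b γ′)
                   (recolour-inverse {f} {g} g∘f col)
                   (trans (cong g (sym fγ≡δ)) (g∘f γ))
                   (occurrence-recolour g occ))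

-- Two avoiders with the same partition and colouring are equal, since the
-- avoidance certificate is a proof of T, which is proof-irrelevant.
avoider-≡ : ∀ {n c a b γ} {p : SetPartition n} {col col′ : Vec (Fin c) n} →
            (t : T (not (eqContains (p , col) a b γ))) (t′ : T (not (eqContains (p , col′) a b γ))) →
            col ≡ col′ → _≡_ {A = Avoiders n c a b γ} ((p , col) , t) ((p , col′) , t′)
avoider-≡ t t′ refl = cong (_ ,_) (T-irrelevant t t′)

recolourAvoider : ∀ {n c} (a b : Fin c) (f g : Fin c → Fin c) {γ δ} →
                  (∀ γ → g (f γ) ≡ γ) → f γ ≡ δ → Avoiders n c a b γ → Avoiders n c a b δ
recolourAvoider a b f g {γ} {δ} g∘f fγ≡δ (((v , r) , col) , avoids) =
  ((v , r) , recolour f col) ,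
  from (avoidance⇔ {r} (recolour f col) a b δ)
       (avoidance-recolour {f} {g} g∘f fγ≡δ col (to (avoidance⇔ {r} col a b γ) avoids))
  where
  open Occurrences v
  open Recolouring v a b

recolouring-bijection : ∀ {n c} (a b : Fin c) (π : Permutation′ c) {γ δ} →
                        π ⟨$⟩ʳ γ ≡ δ → Avoiders n c a b γ ↔ Avoiders n c a b δ
recolouring-bijection {c = c} a b π {γ} {δ} πγ≡δ =
  mk↔ₛ′ (recolourAvoider a b forward backward (λ _ → inverseˡ π) πγ≡δ)
        (recolourAvoider a b backward forward (λ _ → inverseʳ π) π⁻¹δ≡γ)
        (λ (((v , _) , col) , t) → avoider-≡ _ t
           (Recolouring.recolour-inverse v a b {backward} {forward} (λ _ → inverseʳ π) col))
        (λ (((v , _) , col) , t) → avoider-≡ _ t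
           (Recolouring.recolour-inverse v a b {forward} {backward} (λ _ → inverseˡ π) col))
  where
  forward backward : Fin c → Fin c
  forward  = π ⟨$⟩ʳ_
  backward = π ⟨$⟩ˡ_

  π⁻¹δ≡γ : backward δ ≡ γ
  π⁻¹δ≡γ = trans (cong backward (sym πγ≡δ)) (inverseˡ π)

mainTheorem19 : (c n : ℕ) → c ≥ 3 → n ≥ 1 → (a b d : Fin c) →
    a ≢ b → a ≢ d → b ≢ d →
    Avoiders n c a b a ⤖ Avoiders n c a b d
mainTheorem19 c n _ _ a b d _ _ _ =
  ↔⇒⤖ (recolouring-bijection a b (transpose a d) (transpose-source a d))
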